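{- Let $\mathcal{F}$ be an arbitrary input to the 3-SAT problem, with $n$ variables $x_1,\dots,x_n$ and $s$ clauses $Q_1,\dots,Q_s$, let $k\ge 1$ be an integer, and let $G_F$ be the graph associated to $\mathcal{F}$ (and $k$) as described in the context. Then $\dim_k(G_F)\ge k(n+s)$.
   Context: For a connected graph $G$, a vertex $w$ distinguishes $u,v$ if $d_G(u,w)\ne d_G(v,w)$. A set $S\subseteq V(G)$ is a $k$-metric generator if every pair of different vertices is distinguished by at least $k$ elements of $S$; a minimum-cardinality one is a $k$-metric basis, with cardinality $\dim_k(G)$ (the $k$-metric dimension). Construction of $G_F$ (each clause consists of three literals, a literal being $x_i$ or $\overline{x_i}$): (1) For every variable $x_i$ take a cycle $C^i$ of order $4\lceil k/2\rceil+2$ and let $T_i$ and $F_i$ be two diametral (antipodal) vertices of $C^i$. (2) For every clause $Q_j$ take a star $S_{1,4}$ with center $u_j$ and leaves $u_j^1,u_j^2,u_j^3,u_j^4$; if $k\ge 3$, subdivide the edge $u_ju_j^2$ so that the $u_j$–$u_j^2$ path has $\lceil k/2\rceil+1$ vertices and subdivide the edge $u_ju_j^3$ so that the $u_j$–$u_j^3$ path has $\lfloor k/2\rfloor+1$ vertices. (3) If $x_i$ occurs as a positive literal in $Q_j$, add edges $T_iu_j^1$, $F_iu_j^1$, $F_iu_j^4$. (4) If $x_i$ occurs as a negative literal in $Q_j$, add edges $T_iu_j^1$, $F_iu_j^1$, $T_iu_j^4$. (5) For every $l$ such that neither $x_l$ nor $\overline{x_l}$ occurs in $Q_j$, add edges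 $T_lu_j^1$, $T_lu_j^4$, $F_lu_j^1$, $F_lu_j^4$. -}

module Defs where

open import Data.Nat.Base using (ℕ; zero; suc; _+_; _*_; _≤_; _%_; ⌈_/2⌉; ⌊_/2⌋)
open import Data.Fin.Base using (Fin; toℕ)
open import Data.Bool.Base using (Bool; true; false)
open import Data.Product using (Σ; ∃; _×_; _,_; proj₁)
open import Data.Sum using (_⊎_)
open import Data.List.Base using (List; length)
open import Data.List.Relation.Unary.All using (All)
open import Data.List.Relation.Unary.Unique.Propositional using (Unique)
open import Data.List.Membership.Propositional using (_∈_)
open import Relation.Binary.PropositionalEquality using (_≡_; _≢_)
open import Relation.Nullary using (¬_)

record Graph : Set₁ where
  field
    V   : Set
    Adj : V → V → Set

module _ (G : Graph) where
  open Graph G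

  data Walk : V → V → ℕ → Set where
    nil  : ∀ {u} → Walk u u 0
    cons : ∀ {u v w m} → Adj u v → Walk v w m → Walk u w (suc m)

  Dist : V → V → ℕ → Set
  Dist u v m = Walk u v m × (∀ m' → Walk u v m' → m ≤ m')

  Distinguishes : V → V → V → Set
  Distinguishes w u v =
    ∃ λ m₁ → ∃ λ m₂ → Dist u w m₁ × Dist v w m₂ × m₁ ≢ m₂

  IsKMetricGenerator : ℕ → List V → Set
  IsKMetricGenerator k S =
    Unique S ×
    (∀ u v → u ≢ v →
      ∃ λ (L : List V) → Unique L × k ≤ length L ×
        All (λ w → w ∈ S × Distinguishes w u v) L)

-- a literal: variable index and polarity (true = x_i, false = ¬x_i)
Literal : ℕ → Set
Literal n = Fin n × Bool

Clause : ℕ → Set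
Clause n = Fin 3 → Literal n

Formula : ℕ → ℕ → Set
Formula n s = Fin s → Clause n

OccursPos : ∀ {n s} → Formula n s → Fin n → Fin s → Set
OccursPos F i j = ∃ λ r → F j r ≡ (i , true)

OccursNeg : ∀ {n s} → Formula n s → Fin n → Fin s → Set
OccursNeg F i j = ∃ λ r → F j r ≡ (i , false)

Occurs : ∀ {n s} → Formula n s → Fin n → Fin s → Set
Occurs F i j = ∃ λ r → proj₁ (F j r) ≡ i

cycOrd : ℕ → ℕ
cycOrd k = suc (suc (4 * ⌈ k /2⌉))

-- position of F_i on C^i (T_i is at position 0); antipodal to 0
antip : ℕ → ℕ
antip k = 2 * ⌈ k /2⌉ + 1

-- number of vertices other than u_j on the u_j – u_j^2 path
-- (⌈k/2⌉ if k ≥ 3, otherwise the single edge u_j u_j^2)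
len2 : ℕ → ℕ
len2 0 = 1
len2 1 = 1
len2 2 = 1
len2 k@(suc (suc (suc _))) = ⌈ k /2⌉

-- number of vertices other than u_j on the u_j – u_j^3 path
len3 : ℕ → ℕ
len3 0 = 1
len3 1 = 1
len3 2 = 1
len3 k@(suc (suc (suc _))) = ⌊ k /2⌋

data GV (n s k : ℕ) : Set where
  cyc   : Fin n → Fin (cycOrd k) → GV n s k
  cen   : Fin s → GV n s k                    -- u_j
  leaf1 : Fin s → GV n s k                    -- u_j^1
  leaf4 : Fin s → GV n s k                    -- u_j^4
  p2    : Fin s → Fin (len2 k) → GV n s k     -- t-th vertex (t+1 from u_j) on path to u_j^2
  p3    : Fin s → Fin (len3 k) → GV n s k     -- t-th vertex on path to u_j^3

-- directed edge list; adjacency is its symmetric closure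
data GE {n s k : ℕ} (F : Formula n s) : GV n s k → GV n s k → Set where
  e-cyc   : ∀ i (a b : Fin (cycOrd k)) → suc (toℕ a) % cycOrd k ≡ toℕ b →
            GE F (cyc i a) (cyc i b)
  e-l1    : ∀ j → GE F (cen j) (leaf1 j)
  e-l4    : ∀ j → GE F (cen j) (leaf4 j)
  e-p2₀   : ∀ j t → toℕ t ≡ 0 → GE F (cen j) (p2 j t)
  e-p2    : ∀ j t t' → suc (toℕ t) ≡ toℕ t' → GE F (p2 j t) (p2 j t')
  e-p3₀   : ∀ j t → toℕ t ≡ 0 → GE F (cen j) (p3 j t)
  e-p3    : ∀ j t t' → suc (toℕ t) ≡ toℕ t' → GE F (p3 j t) (p3 j t')
  -- T_i u_j^1 and F_i u_j^1 are added in every case (3),(4),(5)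
  e-T1    : ∀ i j a → toℕ a ≡ 0 → GE F (cyc i a) (leaf1 j)
  e-F1    : ∀ i j a → toℕ a ≡ antip k → GE F (cyc i a) (leaf1 j)
  -- (3) positive occurrence: F_i u_j^4
  e-F4pos : ∀ i j a → OccursPos F i j → toℕ a ≡ antip k → GE F (cyc i a) (leaf4 j)
  -- (4) negative occurrence: T_i u_j^4
  e-T4neg : ∀ i j a → OccursNeg F i j → toℕ a ≡ 0 → GE F (cyc i a) (leaf4 j)
  -- (5) no occurrence: T_i u_j^4 and F_i u_j^4
  e-T4no  : ∀ i j a → ¬ Occurs F i j → toℕ a ≡ 0 → GE F (cyc i a) (leaf4 j)
  e-F4no  : ∀ i j a → ¬ Occurs F i j → toℕ a ≡ antip k → GE F (cyc i a) (leaf4 j)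

G[_,_] : ∀ {n s} → Formula n s → ℕ → Graph
G[_,_] {n} {s} F k = record
  { V   = GV n s k
  ; Adj = λ u v → GE F u v ⊎ GE F v u
  }

-- Each variable cycle C^i contains a pair of twins, the two neighbours of T_i, and each
-- clause star a pair of twins, the neighbours of u_j on its paths to u_j^2 and u_j^3. For
-- each pair there is a map of G_F that never increases distances, swaps the pair and
-- fixes every vertex outside the cycle resp. the two paths: the reflection of C^i
-- through T_i and F_i, resp. the map folding each of the two paths of Q_j onto the
-- first vertex of the other. So a twin pair is distinguished only by vertices of its own
-- gadget, and a k-metric generator has at least k vertices in each of the n + s
-- pairwise disjoint gadgets.
module Submission where

open import Defs
open import Data.Nat.Base using (ℕ; zero; suc; _+_; _*_; _∸_; _≤_; _<_; z≤n; s≤s; z<s; ⌈_/2⌉; nonZero)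
open import Data.Nat.Properties
open import Data.Nat.DivMod using (_%_; n%n≡0; m<n⇒m%n≡m)
open import Data.Fin.Base using (Fin; toℕ; fromℕ<; opposite) renaming (zero to fz; suc to fs)
open import Data.Fin.Properties using (toℕ<n; toℕ-fromℕ<; opposite-prop; opposite-involutive)
  renaming (_≟_ to _≟ᶠ_)
open import Data.List.Base using (List; []; _∷_; _++_; length)
open import Data.List.Properties using (length-++; length-++-sucʳ)
open import Data.List.Relation.Unary.All as All using (All; []; _∷_)
import Data.List.Relation.Unary.All.Properties as All
open import Data.List.Relation.Unary.AllPairs using ([]; _∷_)
open import Data.List.Relation.Unary.Any using (here; there)
open import Data.List.Relation.Unary.Unique.Propositional using (Unique)
import Data.List.Relation.Unary.Unique.Propositional.Properties as Unique
open import Data.List.Membership.Propositional using (_∈_)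
open import Data.List.Membership.Propositional.Properties using (∈-++⁺ˡ; ∈-++⁺ʳ; ∈-++⁻; ∈-∃++)
open import Data.Product using (∃; ∃₂; _×_; _,_; proj₁; proj₂; map₂)
open import Data.Sum as Sum using (_⊎_; inj₁; inj₂)
open import Data.Empty using (⊥-elim)
open import Relation.Binary.PropositionalEquality
open import Relation.Nullary using (¬_; yes; no; contradiction)
open import Function.Base using (_∘_)

module _ {A : Set} where

  length-≤-of-⊆ : (L S : List A) → Unique L → All (_∈ S) L → length L ≤ length S
  length-≤-of-⊆ [] S _ _ = z≤n
  length-≤-of-⊆ (x ∷ L) S (x∉L ∷ uniqueL) (x∈S ∷ L⊆S) with ∈-∃++ x∈S
  ... | ys , zs , refl = begin
    suc (length L)          ≤⟨ s≤s (length-≤-of-⊆ L (ys ++ zs) uniqueL (All.zipWith drop-x (x∉L , L⊆S))) ⟩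
    suc (length (ys ++ zs)) ≡⟨ length-++-sucʳ ys x zs ⟨
    length (ys ++ x ∷ zs)   ∎
    where
    open ≤-Reasoning
    drop-x : ∀ {y} → x ≢ y × y ∈ ys ++ x ∷ zs → y ∈ ys ++ zs
    drop-x (x≢y , y∈) with ∈-++⁻ ys y∈
    ... | inj₁ y∈ys         = ∈-++⁺ˡ y∈ys
    ... | inj₂ (here y≡x)   = ⊥-elim (x≢y (sym y≡x))
    ... | inj₂ (there y∈zs) = ∈-++⁺ʳ ys y∈zs

  DistinctIn : List A → ℕ → (A → Set) → Set
  DistinctIn S m P = ∃ λ L → Unique L × m ≤ length L × All (λ w → w ∈ S × P w) L

  union-of-regions : (region : A → ℕ) (k : ℕ) (S : List A) → ∀ c →
    (∀ r → r < c → DistinctIn S k (λ w → region w ≡ r)) →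
    DistinctIn S (k * c) (λ w → region w < c)
  union-of-regions region k S zero _ = [] , [] , ≤-reflexive (*-zeroʳ k) , []
  union-of-regions region k S (suc c) inRegion
    with inRegion c ≤-refl | union-of-regions region k S c (λ r r<c → inRegion r (m<n⇒m<1+n r<c))
  ... | L₁ , unique₁ , k≤L₁ , in₁ | L₂ , unique₂ , kc≤L₂ , in₂ =
    L₁ ++ L₂ , Unique.++⁺ unique₁ unique₂ disjoint , long ,
    All.++⁺ (All.map (map₂ (λ r≡c → ≤-reflexive (cong suc r≡c))) in₁)
            (All.map (map₂ m<n⇒m<1+n) in₂)
    where
    disjoint : ∀ {w} → ¬ (w ∈ L₁ × w ∈ L₂)
    disjoint (w∈L₁ , w∈L₂) = <-irrefl (proj₂ (All.lookup in₁ w∈L₁)) (proj₂ (All.lookup in₂ w∈L₂))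
    long : k * suc c ≤ length (L₁ ++ L₂)
    long rewrite *-suc k c | length-++ L₁ {L₂} = +-mono-≤ k≤L₁ kc≤L₂

  length-≥-regions : (region : A → ℕ) (k c : ℕ) (S : List A) →
    (∀ r → r < c → DistinctIn S k (λ w → region w ≡ r)) →
    k * c ≤ length S
  length-≥-regions region k c S inRegion
    with union-of-regions region k S c inRegion
  ... | L , uniqueL , kc≤L , L⊆S = ≤-trans kc≤L (length-≤-of-⊆ L S uniqueL (All.map proj₁ L⊆S))

module _ (G : Graph) where
  open Graph G

  NonExpanding : (V → V) → Set
  NonExpanding φ = ∀ {x y} → Adj x y → Adj (φ x) (φ y) ⊎ φ x ≡ φ y

  map-walk : ∀ {φ} → NonExpanding φ → ∀ {x y m} → Walk G x y m →
             ∃ λ m′ → m′ ≤ m × Walk G (φ x) (φ y) m′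
  map-walk φ-nonExp nil = 0 , z≤n , nil
  map-walk {φ} φ-nonExp {y = y} (cons x~z walk) with map-walk φ-nonExp walk
  ... | m′ , m′≤m , walk′ with φ-nonExp x~z
  ...   | inj₁ φx~φz = suc m′ , s≤s m′≤m , cons φx~φz walk′
  ...   | inj₂ φx≡φz = m′ , m≤n⇒m≤1+n m′≤m , subst (λ z → Walk G z (φ y) m′) (sym φx≡φz) walk′

  swapped-not-distinguished : ∀ {φ u v w} → NonExpanding φ →
    φ u ≡ v → φ v ≡ u → φ w ≡ w → ¬ Distinguishes G w u v
  swapped-not-distinguished {φ} {u} {v} {w} φ-nonExp φu≡v φv≡u φw≡w
    (m₁ , m₂ , (walk₁ , min₁) , (walk₂ , min₂) , m₁≢m₂)
    with map-walk φ-nonExp walk₁ | map-walk φ-nonExp walk₂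
  ... | a , a≤m₁ , walk₁′ | b , b≤m₂ , walk₂′ =
    m₁≢m₂ (≤-antisym (≤-trans (min₁ b (moved φv≡u walk₂′)) b≤m₂)
                     (≤-trans (min₂ a (moved φu≡v walk₁′)) a≤m₁))
    where
    moved : ∀ {x y m} → φ x ≡ y → Walk G (φ x) (φ w) m → Walk G y w m
    moved {m = m} φx≡y = subst₂ (λ p q → Walk G p q m) φx≡y φw≡w

  TwinsIn : (V → ℕ) → ℕ → Set
  TwinsIn region r = ∃₂ λ u v → u ≢ v × (∀ w → Distinguishes G w u v → region w ≡ r)

  twins-by-swap : ∀ region r φ {u v} → NonExpanding φ → u ≢ v → φ u ≡ v → φ v ≡ u →
    (∀ w → region w ≢ r → φ w ≡ w) → TwinsIn region r
  twins-by-swap region r φ {u} {v} φ-nonExp u≢v φu≡v φv≡u fixes =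
    u , v , u≢v , in-region
    where
    in-region : ∀ w → Distinguishes G w u v → region w ≡ r
    in-region w w-dist with region w ≟ r
    ... | yes w∈r = w∈r
    ... | no  w∉r = ⊥-elim (swapped-not-distinguished φ-nonExp φu≡v φv≡u (fixes w w∉r) w-dist)

  kMetricGenerator-length-≥ : (region : V → ℕ) (c : ℕ) → (∀ r → r < c → TwinsIn region r) →
    ∀ k S → IsKMetricGenerator G k S → k * c ≤ length S
  kMetricGenerator-length-≥ region c twins k S (_ , generates) =
    length-≥-regions region k c S witnesses
    where
    witnesses : ∀ r → r < c → DistinctIn S k (λ w → region w ≡ r)
    witnesses r r<c with twins r r<c
    ... | u , v , u≢v , in-region with generates u v u≢v
    ...   | L , uniqueL , k≤L , distinguishers =
      L , uniqueL , k≤L , All.map (λ { (w∈S , w-dist) → w∈S , in-region _ w-dist }) distinguishers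

-- Negation modulo suc M.
neg : ∀ {M} → Fin (suc M) → Fin (suc M)
neg fz     = fz
neg (fs a) = fs (opposite a)

neg-involutive : ∀ {M} (a : Fin (suc M)) → neg (neg a) ≡ a
neg-involutive fz     = refl
neg-involutive (fs a) = cong fs (opposite-involutive a)

negℕ : ℕ → ℕ → ℕ
negℕ M zero    = zero
negℕ M (suc x) = suc (M ∸ x)

toℕ-neg : ∀ {M} (a : Fin (suc (suc M))) → toℕ (neg a) ≡ negℕ M (toℕ a)
toℕ-neg fz     = refl
toℕ-neg (fs a) = cong suc (opposite-prop a)

negℕ-reverses-step : ∀ M x → x < suc (suc M) →
  suc (negℕ M (suc x % suc (suc M))) % suc (suc M) ≡ negℕ M x
negℕ-reverses-step M zero _
  rewrite m<n⇒m%n≡m {n = suc (suc M)} {m = 1} (s≤s z<s) = n%n≡0 (suc (suc M))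
negℕ-reverses-step M (suc y) (s≤s (s≤s y≤M)) with m≤n⇒m<n∨m≡n y≤M
... | inj₂ refl rewrite n%n≡0 (suc (suc y)) ⦃ nonZero ⦄ | n∸n≡0 y =
  m<n⇒m%n≡m {n = suc (suc y)} (s≤s z<s)
... | inj₁ (s≤s {n = M′} y≤M′)
  rewrite m<n⇒m%n≡m {n = suc (suc (suc M′))} {m = suc (suc y)} (s≤s (s≤s (s≤s y≤M′)))
        | m<n⇒m%n≡m {n = suc (suc (suc M′))} {m = suc (suc (M′ ∸ y))} (s≤s (s≤s (s≤s (m∸n≤m M′ y))))
  = cong suc (sym (+-∸-assoc 1 y≤M′))

neg-reverses-step : ∀ {M} (a b : Fin (suc (suc M))) → suc (toℕ a) % suc (suc M) ≡ toℕ b →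
  suc (toℕ (neg b)) % suc (suc M) ≡ toℕ (neg a)
neg-reverses-step {M} a b a→b rewrite toℕ-neg b | toℕ-neg a | sym a→b =
  negℕ-reverses-step M (toℕ a) (toℕ<n a)

neg-fixes-zero : ∀ {M} (a : Fin (suc M)) → toℕ a ≡ 0 → toℕ (neg a) ≡ 0
neg-fixes-zero fz _ = refl

neg-fixes-antipode : ∀ c (a : Fin (suc (suc (4 * c)))) → toℕ a ≡ 2 * c + 1 → toℕ (neg a) ≡ 2 * c + 1
neg-fixes-antipode c fz a≡ = contradiction (trans a≡ (+-comm (2 * c) 1)) λ ()
neg-fixes-antipode c (fs a) a≡ = begin
  suc (toℕ (opposite a))      ≡⟨ cong suc (opposite-prop a) ⟩
  suc (4 * c ∸ toℕ a)         ≡⟨ cong (λ x → suc (4 * c ∸ x)) a≡2c ⟩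
  suc (4 * c ∸ 2 * c)         ≡⟨ cong (λ x → suc (x ∸ 2 * c)) (*-distribʳ-+ c 2 2) ⟩
  suc (2 * c + 2 * c ∸ 2 * c) ≡⟨ cong suc (m+n∸n≡m (2 * c) (2 * c)) ⟩
  suc (2 * c)                 ≡⟨ +-comm 1 (2 * c) ⟩
  2 * c + 1                   ∎
  where
  open ≡-Reasoning
  a≡2c : toℕ a ≡ 2 * c
  a≡2c = suc-injective (trans a≡ (+-comm (2 * c) 1))

0<len2 : ∀ k → 0 < len2 k
0<len2 0                   = z<s
0<len2 1                   = z<s
0<len2 2                   = z<s
0<len2 (suc (suc (suc _))) = z<s

0<len3 : ∀ k → 0 < len3 k
0<len3 0                   = z<s
0<len3 1                   = z<s
0<len3 2                   = z<s
0<len3 (suc (suc (suc _))) = z<s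

-- For k = 0 the cycles have order 2 and the two neighbours of T_i coincide.
1≢neg-1 : ∀ k → 1 ≤ k → fs fz ≢ neg {suc (4 * ⌈ k /2⌉)} (fs fz)
1≢neg-1 (suc _) _ ()

module _ {n s : ℕ} (F : Formula n s) (k : ℕ) where
  open Graph G[ F , k ] using (V; Adj)

  nonExpanding-from-edges : ∀ {φ} → (∀ {x y} → GE F x y → Adj (φ x) (φ y) ⊎ φ x ≡ φ y) →
    NonExpanding G[ F , k ] φ
  nonExpanding-from-edges φ-edge (inj₁ x→y) = φ-edge x→y
  nonExpanding-from-edges φ-edge (inj₂ y→x) = Sum.map Sum.swap sym (φ-edge y→x)

  same-edge : ∀ {x y} → GE F x y → Adj x y ⊎ x ≡ y
  same-edge x→y = inj₁ (inj₁ x→y)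

  gadget : V → ℕ
  gadget (cyc i _)  = toℕ i
  gadget (p2 j _)   = n + toℕ j
  gadget (p3 j _)   = n + toℕ j
  gadget (cen _)    = n + s
  gadget (leaf1 _)  = n + s
  gadget (leaf4 _)  = n + s

  reflectAt : Fin n → Fin n → Fin (cycOrd k) → Fin (cycOrd k)
  reflectAt i i′ a with i′ ≟ᶠ i
  ... | yes _ = neg a
  ... | no  _ = a

  reflectAt-preserves : (P : Fin (cycOrd k) → Set) → (∀ {a} → P a → P (neg a)) →
    ∀ i i′ {a} → P a → P (reflectAt i i′ a)
  reflectAt-preserves P P-neg i i′ Pa with i′ ≟ᶠ i
  ... | yes _ = P-neg Pa
  ... | no  _ = Pa

  reflectCycle : Fin n → V → V
  reflectCycle i (cyc i′ a) = cyc i′ (reflectAt i i′ a)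
  reflectCycle i w          = w

  reflectCycle-nonExpanding : ∀ i → NonExpanding G[ F , k ] (reflectCycle i)
  reflectCycle-nonExpanding i = nonExpanding-from-edges edge
    where
    at-T : ∀ i′ {a} → toℕ a ≡ 0 → toℕ (reflectAt i i′ a) ≡ 0
    at-T = reflectAt-preserves (λ a → toℕ a ≡ 0) (neg-fixes-zero _) i
    at-F : ∀ i′ {a} → toℕ a ≡ antip k → toℕ (reflectAt i i′ a) ≡ antip k
    at-F = reflectAt-preserves (λ a → toℕ a ≡ antip k) (neg-fixes-antipode ⌈ k /2⌉ _) i
    edge : ∀ {x y} → GE F x y → Adj (reflectCycle i x) (reflectCycle i y) ⊎ reflectCycle i x ≡ reflectCycle i y
    edge (e-cyc i′ a b a→b) with i′ ≟ᶠ i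
    ... | yes _ = inj₁ (inj₂ (e-cyc i′ (neg b) (neg a) (neg-reverses-step a b a→b)))
    ... | no  _ = same-edge (e-cyc i′ a b a→b)
    edge (e-T1 i′ j a a≡T)         = same-edge (e-T1 i′ j _ (at-T i′ a≡T))
    edge (e-F1 i′ j a a≡F)         = same-edge (e-F1 i′ j _ (at-F i′ a≡F))
    edge (e-F4pos i′ j a occ a≡F)  = same-edge (e-F4pos i′ j _ occ (at-F i′ a≡F))
    edge (e-T4neg i′ j a occ a≡T)  = same-edge (e-T4neg i′ j _ occ (at-T i′ a≡T))
    edge (e-T4no i′ j a nocc a≡T)  = same-edge (e-T4no i′ j _ nocc (at-T i′ a≡T))
    edge (e-F4no i′ j a nocc a≡F)  = same-edge (e-F4no i′ j _ nocc (at-F i′ a≡F))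
    edge e@(e-l1 _)         = same-edge e
    edge e@(e-l4 _)         = same-edge e
    edge e@(e-p2₀ _ _ _)    = same-edge e
    edge e@(e-p2 _ _ _ _)   = same-edge e
    edge e@(e-p3₀ _ _ _)    = same-edge e
    edge e@(e-p3 _ _ _ _)   = same-edge e

  reflectCycle-fixes : ∀ i w → gadget w ≢ toℕ i → reflectCycle i w ≡ w
  reflectCycle-fixes i (cyc i′ a) w∉i with i′ ≟ᶠ i
  ... | yes refl = ⊥-elim (w∉i refl)
  ... | no  _    = refl
  reflectCycle-fixes i (cen _)   _ = refl
  reflectCycle-fixes i (leaf1 _) _ = refl
  reflectCycle-fixes i (leaf4 _) _ = refl
  reflectCycle-fixes i (p2 _ _)  _ = refl
  reflectCycle-fixes i (p3 _ _)  _ = refl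

  cyc-injective : ∀ {i a b} → cyc {n} {s} {k} i a ≡ cyc i b → a ≡ b
  cyc-injective refl = refl

  reflectCycle-self : ∀ i a → reflectCycle i (cyc i a) ≡ cyc i (neg a)
  reflectCycle-self i a with i ≟ᶠ i
  ... | yes _  = refl
  ... | no i≢i = ⊥-elim (i≢i refl)

  cycle-twins : 1 ≤ k → ∀ i → TwinsIn G[ F , k ] gadget (toℕ i)
  cycle-twins 1≤k i =
    twins-by-swap G[ F , k ] gadget (toℕ i) (reflectCycle i) (reflectCycle-nonExpanding i)
      (1≢neg-1 k 1≤k ∘ cyc-injective)
      (reflectCycle-self i (fs fz))
      (trans (reflectCycle-self i (neg (fs fz))) (cong (cyc i) (neg-involutive (fs fz))))
      (reflectCycle-fixes i)

  start₂ : Fin (len2 k)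
  start₂ = fromℕ< (0<len2 k)

  start₃ : Fin (len3 k)
  start₃ = fromℕ< (0<len3 k)

  foldClausePaths : Fin s → V → V
  foldClausePaths j (p2 j′ t) with j′ ≟ᶠ j
  ... | yes _ = p3 j start₃
  ... | no  _ = p2 j′ t
  foldClausePaths j (p3 j′ t) with j′ ≟ᶠ j
  ... | yes _ = p2 j start₂
  ... | no  _ = p3 j′ t
  foldClausePaths j w = w

  foldClausePaths-nonExpanding : ∀ j → NonExpanding G[ F , k ] (foldClausePaths j)
  foldClausePaths-nonExpanding j = nonExpanding-from-edges edge
    where
    edge : ∀ {x y} → GE F x y →
      Adj (foldClausePaths j x) (foldClausePaths j y) ⊎ foldClausePaths j x ≡ foldClausePaths j y
    edge (e-p2₀ j′ t t≡0) with j′ ≟ᶠ j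
    ... | yes refl = same-edge (e-p3₀ j start₃ (toℕ-fromℕ< (0<len3 k)))
    ... | no  _    = same-edge (e-p2₀ j′ t t≡0)
    edge (e-p3₀ j′ t t≡0) with j′ ≟ᶠ j
    ... | yes refl = same-edge (e-p2₀ j start₂ (toℕ-fromℕ< (0<len2 k)))
    ... | no  _    = same-edge (e-p3₀ j′ t t≡0)
    edge (e-p2 j′ t t′ t→t′) with j′ ≟ᶠ j
    ... | yes _ = inj₂ refl
    ... | no  _ = same-edge (e-p2 j′ t t′ t→t′)
    edge (e-p3 j′ t t′ t→t′) with j′ ≟ᶠ j
    ... | yes _ = inj₂ refl
    ... | no  _ = same-edge (e-p3 j′ t t′ t→t′)
    edge e@(e-cyc _ _ _ _)       = same-edge e
    edge e@(e-l1 _)              = same-edge e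
    edge e@(e-l4 _)              = same-edge e
    edge e@(e-T1 _ _ _ _)        = same-edge e
    edge e@(e-F1 _ _ _ _)        = same-edge e
    edge e@(e-F4pos _ _ _ _ _)   = same-edge e
    edge e@(e-T4neg _ _ _ _ _)   = same-edge e
    edge e@(e-T4no _ _ _ _ _)    = same-edge e
    edge e@(e-F4no _ _ _ _ _)    = same-edge e

  foldClausePaths-fixes : ∀ j w → gadget w ≢ n + toℕ j → foldClausePaths j w ≡ w
  foldClausePaths-fixes j (p2 j′ t) w∉j with j′ ≟ᶠ j
  ... | yes refl = ⊥-elim (w∉j refl)
  ... | no  _    = refl
  foldClausePaths-fixes j (p3 j′ t) w∉j with j′ ≟ᶠ j
  ... | yes refl = ⊥-elim (w∉j refl)
  ... | no  _    = refl
  foldClausePaths-fixes j (cyc _ _) _ = refl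
  foldClausePaths-fixes j (cen _)   _ = refl
  foldClausePaths-fixes j (leaf1 _) _ = refl
  foldClausePaths-fixes j (leaf4 _) _ = refl

  foldClausePaths-p2 : ∀ j t → foldClausePaths j (p2 j t) ≡ p3 j start₃
  foldClausePaths-p2 j t with j ≟ᶠ j
  ... | yes _  = refl
  ... | no j≢j = ⊥-elim (j≢j refl)

  foldClausePaths-p3 : ∀ j t → foldClausePaths j (p3 j t) ≡ p2 j start₂
  foldClausePaths-p3 j t with j ≟ᶠ j
  ... | yes _  = refl
  ... | no j≢j = ⊥-elim (j≢j refl)

  clause-twins : ∀ j → TwinsIn G[ F , k ] gadget (n + toℕ j)
  clause-twins j =
    twins-by-swap G[ F , k ] gadget (n + toℕ j) (foldClausePaths j) (foldClausePaths-nonExpanding j)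
      (λ ()) (foldClausePaths-p2 j start₂) (foldClausePaths-p3 j start₃) (foldClausePaths-fixes j)

  gadget-twins : 1 ≤ k → ∀ r → r < n + s → TwinsIn G[ F , k ] gadget r
  gadget-twins 1≤k r r<n+s with r <? n
  ... | yes r<n =
    subst (TwinsIn G[ F , k ] gadget) (toℕ-fromℕ< r<n) (cycle-twins 1≤k (fromℕ< r<n))
  ... | no  r≮n with m≤n⇒∃[o]m+o≡n (≮⇒≥ r≮n)
  ...   | d , refl =
    subst (TwinsIn G[ F , k ] gadget) (cong (n +_) (toℕ-fromℕ< d<s)) (clause-twins (fromℕ< d<s))
    where
    d<s : d < s
    d<s = +-cancelˡ-< n d s r<n+s

proposition6 : (n s k : ℕ) → 1 ≤ k → (F : Formula n s) →
               (S : List (Graph.V G[ F , k ])) →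
               IsKMetricGenerator G[ F , k ] k S →
               k * (n + s) ≤ length S
proposition6 n s k 1≤k F =
  kMetricGenerator-length-≥ G[ F , k ] (gadget F k) (n + s) (gadget-twins F k 1≤k) k
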